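{- If $\sigma$ and $\tau$ are permutations and $\sigma$ is contained in $\tau$, then $t_{\operatorname{rev}}(\tau)\ge t_{\operatorname{rev}}(\sigma)$.
   Context: A permutation $\pi\in S_n$ contains $\sigma\in S_k$ if there are indices $\alpha_1<\cdots<\alpha_k$ with $\pi_{\alpha_i}<\pi_{\alpha_j}$ iff $\sigma_i<\sigma_j$. Sorting procedure: a permutation $\pi$ is processed using an input sequence (initially $\pi_1,\ldots,\pi_n$), a stack and an output. Let $m$ be the smallest value not yet output. At each step: if the stack's top entry equals $m$, pop it to the output; otherwise, if the input is nonempty, push the next input entry onto the stack. When no move is possible and the stack is nonempty, the remaining stack entries are returned to the input in the reverse of their order in the previous input (i.e. listed from top of stack to bottom), and the procedure is repeated. The rev-tier $t_{\operatorname{rev}}(\pi)$ is the number of times entries must be returned to the input before the output is $1,2,\ldots,n$. -}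

module Defs where

open import Data.Nat using (ℕ; zero; suc; _<_; _≟_)
open import Data.Nat.Properties using ()
open import Data.List using (List; []; _∷_; length; map; upTo; lookup)
open import Data.List.Relation.Binary.Permutation.Propositional using (_↭_)
open import Data.Fin using (Fin) renaming (_<_ to _<ᶠ_)
open import Data.Product using (Σ; _×_; _,_)
open import Function.Bundles using (_⇔_)
open import Relation.Nullary using (yes; no)

oneTo : ℕ → List ℕ
oneTo n = map suc (upTo n)

IsPerm : List ℕ → Set
IsPerm π = π ↭ oneTo (length π)

Contains : List ℕ → List ℕ → Set
Contains π σ =
  Σ (Fin (length σ) → Fin (length π)) λ α →
    (∀ i j → i <ᶠ j → α i <ᶠ α j) ×
    (∀ i j → (lookup π (α i) < lookup π (α j)) ⇔ (lookup σ i < lookup σ j))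

-- State of one pass: m = smallest value not yet output, stack as a list
-- with its top entry at the head.
record State : Set where
  constructor st
  field
    next  : ℕ
    stack : List ℕ

popAll : ℕ → List ℕ → State
popAll m [] = st m []
popAll m (x ∷ s) with x ≟ m
... | yes _ = popAll (suc m) s
... | no  _ = st m (x ∷ s)

pass : List ℕ → State → State
pass []      (st m s) = popAll m s
pass (x ∷ xs) (st m s) with popAll m s
... | st m' s' = pass xs (st m' (x ∷ s'))

-- Repeated passes; each time no move is possible with a nonempty stack,
-- the stack entries are returned to the input listed from top to bottom
-- (i.e. the stack list itself), and this is counted once.
-- The fuel bounds the number of passes (each pass outputs at least one
-- entry, so length π + 1 passes always suffice for a permutation).
returns : ℕ → List ℕ → ℕ → ℕ
returns zero    _   _ = zero
returns (suc f) inp m with pass inp (st m [])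
... | st m' []      = zero
... | st m' (y ∷ s) = suc (returns f (y ∷ s) m')

-- rev-tier of π (values 1..n, so the first value to output is 1).
revTier : List ℕ → ℕ
revTier π = returns (suc (length π)) π 1

module Submission where

-- Idea: if τ contains σ, there is a strictly increasing map f : ℕ → ℕ sending
-- every value of σ to the value of τ in the corresponding pattern position
-- (values outside σ are sent above every value of τ).  Under f the word σ is
-- a subword of τ, and the two sorting runs can be compared step by step: we
-- maintain an invariant ("τ simulates σ") between a configuration of the
-- σ-run and one of the τ-run, saying that the f-image of σ's stack and input
-- are subwords of τ's stack and input, that the τ-run has not output more
-- than the σ-run, and that a value the τ-run still holds is still held by
-- the σ-run.  The invariant survives every pop and push, hence a whole pass,
-- and at the end of a pass σ's stack embeds into τ's stack: whenever σ must
-- return entries to the input, so must τ.  Counting returns gives the claim.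

open import Defs
open import Data.List using (List; []; _∷_; _++_; length; lookup)
open import Data.List.Properties using (++-identityʳ)
open import Data.Nat using (ℕ; zero; suc; _≤_; _<_; z≤n; s≤s; _+_; _≟_)
open import Data.Nat.Properties
open import Data.Fin using (Fin; toℕ) renaming (zero to fzero; suc to fsuc; _<_ to _<ᶠ_)
open import Data.List.Membership.Propositional using (_∈_; _∉_)
open import Data.List.Membership.Propositional.Properties
  using (∈-map⁺; ∈-map⁻; ∈-++⁺ˡ; ∈-++⁺ʳ; ∈-++⁻; ∈-upTo⁺; ∈-upTo⁻; ∈-lookup)
open import Data.List.Membership.DecPropositional _≟_ using (_∈?_)
open import Data.List.Relation.Unary.Any using (here; there; index)
open import Data.List.Relation.Unary.Any.Properties using (lookup-index)
open import Data.List.Relation.Unary.All as All using (All; []; _∷_)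
open import Data.List.Relation.Unary.All.Properties using (All¬⇒¬Any)
open import Data.List.Relation.Unary.Unique.Propositional as Unique using (Unique)
open import Data.List.Relation.Unary.Unique.Propositional.Properties using (upTo⁺; map⁺)
open import Data.List.Relation.Binary.Permutation.Propositional using (_↭_; ↭-sym; ↭⇒↭ₛ)
open import Data.List.Relation.Binary.Permutation.Propositional.Properties
  using (∈-resp-↭; All-resp-↭; shift)
import Data.List.Relation.Binary.Permutation.Setoid.Properties as SetoidPerm
open import Data.List.Relation.Binary.Sublist.Heterogeneous
  using (Sublist; []; _∷ʳ_; _∷_; minimum)
  renaming (lookup to sublist-lookup)
open import Data.List.Relation.Binary.Sublist.Heterogeneous.Properties using (length-mono-≤)
open import Data.Product using (_×_; _,_; proj₁; proj₂)
open import Data.Sum using (inj₁; inj₂)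
open import Data.Empty using (⊥-elim)
open import Relation.Nullary using (¬_; Dec; yes; no)
open import Relation.Binary.PropositionalEquality
open import Relation.Binary.Definitions using (tri<; tri≈; tri>)
open import Function.Bundles using (_⇔_; Equivalence)

popAll-idempotent : ∀ m s →
  popAll (State.next (popAll m s)) (State.stack (popAll m s)) ≡ popAll m s
popAll-idempotent m [] = refl
popAll-idempotent m (x ∷ s) with x ≟ m
... | yes _ = popAll-idempotent (suc m) s
... | no x≢m with x ≟ m
...   | yes x≡m = ⊥-elim (x≢m x≡m)
...   | no _ = refl

pass-popAll : ∀ xs m s → pass xs (st m s) ≡ pass xs (popAll m s)
pass-popAll [] m s = sym (popAll-idempotent m s)
pass-popAll (y ∷ ys) m s =
  cong (λ P → pass ys (st (State.next P) (y ∷ State.stack P)))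
       (sym (popAll-idempotent m s))

popAll-top : ∀ m s → popAll m (m ∷ s) ≡ popAll (suc m) s
popAll-top m s with m ≟ m
... | yes _ = refl
... | no m≢m = ⊥-elim (m≢m refl)

returns-mono-fuel : ∀ F G inp m → F ≤ G → returns F inp m ≤ returns G inp m
returns-mono-fuel zero G inp m _ = z≤n
returns-mono-fuel (suc F) (suc G) inp m (s≤s F≤G) with pass inp (st m [])
... | st m' [] = z≤n
... | st m' (y ∷ s) = s≤s (returns-mono-fuel F G (y ∷ s) m' F≤G)

unique-resp-↭ : ∀ {xs ys : List ℕ} → xs ↭ ys → Unique xs → Unique ys
unique-resp-↭ xs↭ys = SetoidPerm.Unique-resp-↭ (setoid ℕ) (↭⇒↭ₛ xs↭ys)

head-∉ : ∀ {x : ℕ} {xs} → Unique (x ∷ xs) → x ∉ xs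
head-∉ u = All¬⇒¬Any (Unique.head u)

module Simulation (f : ℕ → ℕ) (f-mono : ∀ {a b} → a < b → f a < f b) where

  f-injective : ∀ {a b} → f a ≡ f b → a ≡ b
  f-injective {a} {b} fa≡fb with <-cmp a b
  ... | tri< a<b _ _ = ⊥-elim (<-irrefl fa≡fb (f-mono a<b))
  ... | tri≈ _ a≡b _ = a≡b
  ... | tri> _ _ b<a = ⊥-elim (<-irrefl (sym fa≡fb) (f-mono b<a))

  _⊑_ : List ℕ → List ℕ → Set
  _⊑_ = Sublist (λ x y → f x ≡ y)

  ⊑-∈ : ∀ {xs ys x} → xs ⊑ ys → x ∈ xs → f x ∈ ys
  ⊑-∈ = sublist-lookup λ { fa≡b refl → fa≡b }

  ⊑-[] : ∀ {xs} → xs ⊑ [] → xs ≡ []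
  ⊑-[] [] = refl

  ⊑-drop-head : ∀ {x xs ys} → (x ∷ xs) ⊑ ys → xs ⊑ ys
  ⊑-drop-head (y ∷ʳ p) = y ∷ʳ ⊑-drop-head p
  ⊑-drop-head (_ ∷ p) = _ ∷ʳ p

  -- The σ-configuration (next value m', stack s', input xs') is simulated
  -- by the τ-configuration (m, s, xs).
  record Simulates (m' : ℕ) (s' xs' : List ℕ) (m : ℕ) (s xs : List ℕ) : Set where
    field
      stack⊑   : s' ⊑ s
      input⊑   : xs' ⊑ xs
      next≤    : m ≤ f m'
      pending≥ : All (m' ≤_) (s' ++ xs')
      uniqueτ  : Unique (s ++ xs)
      uniqueσ  : Unique (s' ++ xs')
      retained : ∀ v → m' ≤ v → f v ∈ s ++ xs → v ∈ s' ++ xs'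
  open Simulates

  SimulatesAt : State → List ℕ → State → List ℕ → Set
  SimulatesAt (st m' s') xs' (st m s) xs = Simulates m' s' xs' m s xs

  pop-σ : ∀ {m' s' xs' m s xs} →
    Simulates m' (m' ∷ s') xs' m s xs → Simulates (suc m') s' xs' m s xs
  pop-σ {m'} I = record
    { stack⊑ = ⊑-drop-head (stack⊑ I) ; input⊑ = input⊑ I
    ; next≤ = ≤-trans (next≤ I) (<⇒≤ (f-mono (n<1+n m')))
    ; pending≥ = raise (head-∉ (uniqueσ I)) (All.tail (pending≥ I))
    ; uniqueτ = uniqueτ I ; uniqueσ = Unique.tail (uniqueσ I)
    ; retained = λ v m'<v fv∈ → not-head v m'<v (retained I v (<⇒≤ m'<v) fv∈) }
    where
    raise : ∀ {l} → m' ∉ l → All (m' ≤_) l → All (suc m' ≤_) l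
    raise m'∉ [] = []
    raise m'∉ (m'≤x ∷ rest) =
      ≤∧≢⇒< m'≤x (λ eq → m'∉ (here eq)) ∷ raise (λ q → m'∉ (there q)) rest
    not-head : ∀ {l} v → m' < v → v ∈ m' ∷ l → v ∈ l
    not-head v m'<v (here v≡m') = ⊥-elim (<-irrefl (sym v≡m') m'<v)
    not-head v m'<v (there v∈l) = v∈l

  popAll-σ : ∀ m' s' {xs' m s xs} →
    Simulates m' s' xs' m s xs → SimulatesAt (popAll m' s') xs' (st m s) xs
  popAll-σ m' [] I = I
  popAll-σ m' (x ∷ s') I with x ≟ m'
  ... | yes refl = popAll-σ (suc m') s' (pop-σ I)
  ... | no _ = I

  TopAvoids : List ℕ → ℕ → Set
  TopAvoids s' m = ∀ {j s₁} → s' ≡ j ∷ s₁ → ¬ f j ≡ m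

  pop-τ : ∀ {m' s' xs' m s xs} →
    Simulates m' s' xs' m (m ∷ s) xs → TopAvoids s' m →
    Simulates m' s' xs' (suc m) s xs
  pop-τ {m'} {s'} {xs'} {m} {s} {xs} I avoids = record
    { stack⊑ = stack⊑' ; input⊑ = input⊑ I
    ; next≤ = ≤∧≢⇒< (next≤ I) (λ m≡fm' → fm'≢m (sym m≡fm'))
    ; pending≥ = pending≥ I ; uniqueτ = Unique.tail (uniqueτ I) ; uniqueσ = uniqueσ I
    ; retained = λ v m'≤v fv∈ → retained I v m'≤v (there fv∈) }
    where
    stack⊑' : s' ⊑ s
    stack⊑' with stack⊑ I
    ... | _ ∷ʳ p = p
    ... | fj≡m ∷ _ = ⊥-elim (avoids refl fj≡m)
    -- otherwise m' is still held by σ, so m would occur twice in τ's configuration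
    fm'≢m : ¬ f m' ≡ m
    fm'≢m fm'≡m with ∈-++⁻ s' (retained I m' ≤-refl (here fm'≡m))
    ... | inj₁ m'∈s' = head-∉ (uniqueτ I) (∈-++⁺ˡ (subst (_∈ s) fm'≡m (⊑-∈ stack⊑' m'∈s')))
    ... | inj₂ m'∈xs' = head-∉ (uniqueτ I) (∈-++⁺ʳ s (subst (_∈ xs) fm'≡m (⊑-∈ (input⊑ I) m'∈xs')))

  pop-both : ∀ {m' s' xs' m s xs} → f m' ≡ m →
    Simulates m' (m' ∷ s') xs' m (m ∷ s) xs → Simulates (suc m') s' xs' (suc m) s xs
  pop-both fm'≡m I = pop-τ (pop-σ I) avoids
    where
    avoids : TopAvoids _ _
    avoids refl fj≡m with f-injective (trans fj≡m (sym fm'≡m))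
    ... | refl = head-∉ (uniqueσ I) (here refl)

  top-is-next : ∀ {m' j s' xs' m s xs} →
    Simulates m' (j ∷ s') xs' m s xs → f j ≡ m → j ≡ m'
  top-is-next {m'} {j} I fj≡m with <-cmp m' j
  ... | tri< m'<j _ _ =
    ⊥-elim (<-irrefl refl (<-≤-trans (subst (f m' <_) fj≡m (f-mono m'<j)) (next≤ I)))
  ... | tri≈ _ m'≡j _ = sym m'≡j
  ... | tri> _ _ j<m' = ⊥-elim (<-irrefl refl (<-≤-trans j<m' (All.head (pending≥ I))))

  popAll-both : ∀ m s {m' s' xs' xs} →
    Simulates m' s' xs' m s xs → SimulatesAt (popAll m' s') xs' (popAll m s) xs
  popAll-both m [] {m'} {s'} I = popAll-σ m' s' I
  popAll-both m (x ∷ s) {m'} {s'} I with x ≟ m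
  popAll-both m (x ∷ s) {m'} {s'} I | no _ = popAll-σ m' s' I
  popAll-both m (m ∷ s) {m'} {[]} I | yes refl = popAll-both (suc m) s (pop-τ I λ ())
  popAll-both m (m ∷ s) {m'} {j ∷ s₁} I | yes refl with f j ≟ m
  ... | no fj≢m = popAll-both (suc m) s (pop-τ I λ { refl → fj≢m })
  ... | yes fj≡m with top-is-next I fj≡m
  ...   | refl rewrite popAll-top j s₁ = popAll-both (suc m) s (pop-both fj≡m I)

  push-τ : ∀ {m' s' xs' m s x xs} →
    Simulates m' s' xs' m s (x ∷ xs) → xs' ⊑ xs → Simulates m' s' xs' m (x ∷ s) xs
  push-τ {s = s} {x} {xs} I xs'⊑xs = record
    { stack⊑ = x ∷ʳ stack⊑ I ; input⊑ = xs'⊑xs ; next≤ = next≤ I ; pending≥ = pending≥ I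
    ; uniqueτ = unique-resp-↭ (shift x s xs) (uniqueτ I) ; uniqueσ = uniqueσ I
    ; retained = λ v m'≤v fv∈ → retained I v m'≤v (∈-resp-↭ (↭-sym (shift x s xs)) fv∈) }

  push-both : ∀ {m' s' x' xs' m s x xs} →
    Simulates m' s' (x' ∷ xs') m s (x ∷ xs) → f x' ≡ x → xs' ⊑ xs →
    Simulates m' (x' ∷ s') xs' m (x ∷ s) xs
  push-both {s' = s'} {x'} {xs'} {s = s} {x} {xs} I fx'≡x xs'⊑xs = record
    { stack⊑ = fx'≡x ∷ stack⊑ I ; input⊑ = xs'⊑xs ; next≤ = next≤ I
    ; pending≥ = All-resp-↭ (shift x' s' xs') (pending≥ I)
    ; uniqueτ = unique-resp-↭ (shift x s xs) (uniqueτ I)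
    ; uniqueσ = unique-resp-↭ (shift x' s' xs') (uniqueσ I)
    ; retained = λ v m'≤v fv∈ → ∈-resp-↭ (shift x' s' xs')
        (retained I v m'≤v (∈-resp-↭ (↭-sym (shift x s xs)) fv∈)) }

  pass-simulates : ∀ xs xs' P' P →
    SimulatesAt P' xs' P xs → SimulatesAt (pass xs' P') [] (pass xs P) []
  push-then-pass : ∀ x xs xs' P' P → SimulatesAt P' xs' P (x ∷ xs) →
    SimulatesAt (pass xs' P') [] (pass xs (st (State.next P) (x ∷ State.stack P))) []

  pass-simulates [] xs' P' P I with ⊑-[] (input⊑ I)
  ... | refl = popAll-both (State.next P) (State.stack P) I
  pass-simulates (x ∷ xs) xs' P' P I =
    subst (λ Q → SimulatesAt Q [] (pass (x ∷ xs) P) [])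
          (sym (pass-popAll xs' (State.next P') (State.stack P')))
          (push-then-pass x xs xs'
            (popAll (State.next P') (State.stack P')) (popAll (State.next P) (State.stack P))
            (popAll-both (State.next P) (State.stack P) I))

  push-then-pass x xs xs' P' P I with input⊑ I
  ... | _ ∷ʳ xs'⊑xs =
    pass-simulates xs xs' P' (st (State.next P) (x ∷ State.stack P)) (push-τ I xs'⊑xs)
  ... | fx'≡x ∷ xs'⊑xs =
    pass-simulates xs _ _ (st (State.next P) (x ∷ State.stack P))
      (push-both (popAll-σ (State.next P') (State.stack P') I) fx'≡x xs'⊑xs)

  return-stacks : ∀ {m' s' m s} → Simulates m' s' [] m s [] → Simulates m' [] s' m [] s
  return-stacks {m'} {s'} {m} {s} I = record
    { stack⊑ = [] ; input⊑ = stack⊑ I ; next≤ = next≤ I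
    ; pending≥ = subst (All (m' ≤_)) (++-identityʳ s') (pending≥ I)
    ; uniqueτ = subst Unique (++-identityʳ s) (uniqueτ I)
    ; uniqueσ = subst Unique (++-identityʳ s') (uniqueσ I)
    ; retained = λ v m'≤v fv∈ → subst (v ∈_) (++-identityʳ s')
        (retained I v m'≤v (subst (f v ∈_) (sym (++-identityʳ s)) fv∈)) }

  returns-simulates : ∀ F xs' m' xs m →
    Simulates m' [] xs' m [] xs → returns F xs' m' ≤ returns F xs m
  returns-simulates zero xs' m' xs m I = z≤n
  returns-simulates (suc F) xs' m' xs m I
    with pass xs' (st m' []) | pass xs (st m []) | pass-simulates xs xs' (st m' []) (st m []) I
  ... | st k' [] | _ | _ = z≤n
  ... | st k' (y ∷ s') | st k [] | J with ⊑-[] (stack⊑ J)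
  ...   | ()
  returns-simulates (suc F) xs' m' xs m I | st k' (y ∷ s') | st k (z ∷ s) | J =
    s≤s (returns-simulates F (y ∷ s') k' (z ∷ s) k (return-stacks J))

predFin : ∀ {k} (j : Fin (suc k)) → 0 < toℕ j → Fin k
predFin (fsuc j) _ = j

fsuc-predFin : ∀ {k} (j : Fin (suc k)) (0<j : 0 < toℕ j) → fsuc (predFin j 0<j) ≡ j
fsuc-predFin (fsuc j) _ = refl

predFin-mono : ∀ {k} (a b : Fin (suc k)) (0<a : 0 < toℕ a) (0<b : 0 < toℕ b) →
  a <ᶠ b → predFin a 0<a <ᶠ predFin b 0<b
predFin-mono (fsuc a) (fsuc b) _ _ (s≤s a<b) = a<b

sublist-from-positions : ∀ {A B : Set} {R : A → B → Set} (xs : List A) (ys : List B)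
  (h : Fin (length xs) → Fin (length ys)) → (∀ i j → i <ᶠ j → h i <ᶠ h j) →
  (∀ i → R (lookup xs i) (lookup ys (h i))) → Sublist R xs ys
sublist-from-positions [] ys h _ _ = minimum ys
sublist-from-positions (x ∷ xs) [] h _ _ with h fzero
... | ()
sublist-from-positions {R = R} (x ∷ xs) (y ∷ ys) h h-mono h-rel = by-first-position (h fzero) refl
  where
  -- Either the first entry of xs sits at the first position of ys and both are
  -- matched, or the first entry of ys is skipped; later positions shift down.
  by-first-position : ∀ j → h fzero ≡ j → Sublist R (x ∷ xs) (y ∷ ys)
  by-first-position fzero h0≡0 =
    subst (R x) (cong (lookup (y ∷ ys)) h0≡0) (h-rel fzero) ∷
    sublist-from-positions xs ys (λ i → predFin (h (fsuc i)) (later i))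
      (λ i j i<j → predFin-mono _ _ _ _ (h-mono (fsuc i) (fsuc j) (s≤s i<j)))
      (λ i → subst (R (lookup xs i)) (cong (lookup (y ∷ ys)) (sym (fsuc-predFin _ (later i))))
                   (h-rel (fsuc i)))
    where
    later : ∀ i → 0 < toℕ (h (fsuc i))
    later i = subst (λ j → j <ᶠ h (fsuc i)) h0≡0 (h-mono fzero (fsuc i) (s≤s z≤n))
  by-first-position (fsuc _) h0≡j =
    y ∷ʳ sublist-from-positions (x ∷ xs) ys (λ i → predFin (h i) (positive i))
      (λ i j i<j → predFin-mono _ _ _ _ (h-mono i j i<j))
      (λ i → subst (R (lookup (x ∷ xs) i)) (cong (lookup (y ∷ ys)) (sym (fsuc-predFin _ (positive i))))
                   (h-rel i))
    where
    positive : ∀ i → 0 < toℕ (h i)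
    positive fzero = subst (λ j → 0 < toℕ j) (sym h0≡j) (s≤s z≤n)
    positive (fsuc i) = <-trans (positive fzero) (h-mono fzero (fsuc i) (s≤s z≤n))

perm-range : ∀ {π x} → IsPerm π → x ∈ π → 1 ≤ x × x ≤ length π
perm-range π↭ x∈π with ∈-map⁻ suc (∈-resp-↭ π↭ x∈π)
... | y , y∈upTo , refl = s≤s z≤n , ∈-upTo⁻ y∈upTo

perm-complete : ∀ {π x} → IsPerm π → 1 ≤ x → x ≤ length π → x ∈ π
perm-complete {x = suc u} π↭ _ x≤n = ∈-resp-↭ (↭-sym π↭) (∈-map⁺ suc (∈-upTo⁺ x≤n))

perm-unique : ∀ {π} → IsPerm π → Unique π
perm-unique {π} π↭ = unique-resp-↭ (↭-sym π↭) (map⁺ suc-injective (upTo⁺ (length π)))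

module Occurrence (σ τ : List ℕ) (σ-perm : IsPerm σ) (τ-perm : IsPerm τ)
  (α : Fin (length σ) → Fin (length τ))
  (α-mono : ∀ i j → i <ᶠ j → α i <ᶠ α j)
  (α-order : ∀ i j → (lookup τ (α i) < lookup τ (α j)) ⇔ (lookup σ i < lookup σ j)) where

  n : ℕ
  n = length τ

  τ-range : ∀ i → 1 ≤ lookup τ i × lookup τ i ≤ n
  τ-range i = perm-range τ-perm (∈-lookup i)

  -- A value of σ goes to the corresponding pattern value of τ, any other
  -- value v to v + n, above all values of τ.
  embedAt : ∀ v → Dec (v ∈ σ) → ℕ
  embedAt v (yes v∈σ) = lookup τ (α (index v∈σ))
  embedAt v (no _) = v + n

  embed : ℕ → ℕ
  embed zero = zero
  embed (suc u) = embedAt (suc u) (suc u ∈? σ)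

  embedAt-positive : ∀ u d → 1 ≤ embedAt (suc u) d
  embedAt-positive u (yes _) = proj₁ (τ-range _)
  embedAt-positive u (no _) = s≤s z≤n

  -- Since σ's values form an initial segment, a missing value lies above all of σ.
  embedAt-mono : ∀ a b (da : Dec (a ∈ σ)) (db : Dec (b ∈ σ)) → 1 ≤ a → a < b →
    embedAt a da < embedAt b db
  embedAt-mono a b (yes a∈σ) (yes b∈σ) _ a<b =
    Equivalence.from (α-order (index a∈σ) (index b∈σ))
      (subst₂ _<_ (lookup-index a∈σ) (lookup-index b∈σ) a<b)
  embedAt-mono a zero _ _ _ ()
  embedAt-mono a (suc w) (yes _) (no _) _ _ =
    <-≤-trans (s≤s (proj₂ (τ-range _))) (s≤s (m≤n+m n w))
  embedAt-mono a b (no a∉σ) (yes b∈σ) 1≤a a<b =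
    ⊥-elim (a∉σ (perm-complete σ-perm 1≤a (<⇒≤ (<-≤-trans a<b (proj₂ (perm-range σ-perm b∈σ))))))
  embedAt-mono a b (no _) (no _) _ a<b = +-monoˡ-< n a<b

  embed-mono : ∀ {a b} → a < b → embed a < embed b
  embed-mono {zero} {suc w} _ = embedAt-positive w (suc w ∈? σ)
  embed-mono {suc u} {suc w} a<b = embedAt-mono (suc u) (suc w) (suc u ∈? σ) (suc w ∈? σ) (s≤s z≤n) a<b

  open Simulation embed embed-mono

  embed-pattern : ∀ i → embed (lookup σ i) ≡ lookup τ (α i)
  embed-pattern i = at (lookup σ i) refl
    where
    at : ∀ v → v ≡ lookup σ i → embed v ≡ lookup τ (α i)
    at zero 0≡σi = ⊥-elim (<-irrefl 0≡σi (proj₁ (perm-range σ-perm (∈-lookup i))))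
    at (suc u) v≡σi with suc u ∈? σ
    ... | no v∉σ = ⊥-elim (v∉σ (subst (_∈ σ) (sym v≡σi) (∈-lookup i)))
    ... | yes v∈σ with <-cmp (lookup τ (α (index v∈σ))) (lookup τ (α i))
    ...   | tri< lt _ _ =
      ⊥-elim (<-irrefl (trans (sym (lookup-index v∈σ)) v≡σi) (Equivalence.to (α-order _ _) lt))
    ...   | tri≈ _ eq _ = eq
    ...   | tri> _ _ gt =
      ⊥-elim (<-irrefl (trans (sym v≡σi) (lookup-index v∈σ)) (Equivalence.to (α-order _ _) gt))

  σ⊑τ : σ ⊑ τ
  σ⊑τ = sublist-from-positions σ τ α α-mono embed-pattern

  embed-reflects : ∀ v → 1 ≤ v → embed v ∈ τ → v ∈ σ
  embed-reflects (suc u) _ = reflects (suc u ∈? σ)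
    where
    reflects : ∀ d → embedAt (suc u) d ∈ τ → suc u ∈ σ
    reflects (yes v∈σ) _ = v∈σ
    reflects (no _) fv∈τ =
      ⊥-elim (<-irrefl refl (<-≤-trans (s≤s (m≤n+m n u)) (proj₂ (perm-range τ-perm fv∈τ))))

  initial : Simulates 1 [] σ 1 [] τ
  initial = record
    { stack⊑ = [] ; input⊑ = σ⊑τ ; next≤ = embedAt-positive 0 (1 ∈? σ)
    ; pending≥ = All.tabulate (λ v∈σ → proj₁ (perm-range σ-perm v∈σ))
    ; uniqueτ = perm-unique τ-perm ; uniqueσ = perm-unique σ-perm
    ; retained = embed-reflects }

  -- σ needs no more fuel than τ, and with equal fuel the simulation applies.
  revTier-mono : revTier σ ≤ revTier τ
  revTier-mono = begin
    returns (suc (length σ)) σ 1 ≤⟨ returns-mono-fuel _ _ σ 1 (s≤s (length-mono-≤ σ⊑τ)) ⟩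
    returns (suc n) σ 1          ≤⟨ returns-simulates (suc n) σ 1 τ 1 initial ⟩
    returns (suc n) τ 1          ∎
    where open ≤-Reasoning

mainTheorem2 : (σ τ : List ℕ) → IsPerm σ → IsPerm τ → Contains τ σ →
    revTier σ ≤ revTier τ
mainTheorem2 σ τ σ-perm τ-perm (α , α-mono , α-order) =
  Occurrence.revTier-mono σ τ σ-perm τ-perm α α-mono α-order
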